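{- The first difference sequence $\Delta(\mathbf{t}_{3/2})$ is $3/2$-automatic.
   Context: Base-$3/2$ expansions: every integer $n\ge0$ has a unique expansion $\langle n\rangle_{3/2}=d_k\cdots d_1d_0$ over digits $\{0,1,2\}$ (empty for $n=0$) with $n=\sum_i d_i\,\frac12\left(\frac32\right)^i$, obtained by setting $N_0=n$ and writing $2N_i=3N_{i+1}+d_i$ with $d_i\in\{0,1,2\}$ until $N_{k+1}=0$. A sequence $(y_n)_{n\ge0}$ is $3/2$-automatic if there is a deterministic finite automaton with output over the alphabet $\{0,1,2\}$ whose output on input $\langle n\rangle_{3/2}$ (read most significant digit first) is $y_n$, for all $n$. The Thue--Morse word in base $3/2$ is $\mathbf{t}_{3/2}=(t_n)_{n\ge0}$ with $t_n$ the sum of the digits of $\langle n\rangle_{3/2}$ modulo $2$; equivalently, the unique binary sequence with $t_0=0$ and $t_{3n}=t_{3n+1}=t_{2n}$, $t_{3n+2}=1-t_{2n+1}$ for all $n\ge 0$. For a binary sequence $\mathbf{x}$, $\Delta(\mathbf{x})=(x_{n+1}-x_n\bmod 2)_{n\ge0}$. -}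

module Defs where

open import Data.Nat using (ℕ; zero; suc; _+_; _*_; _%_; _/_)
open import Data.Nat.DivMod using (_mod_)
open import Data.Fin using (Fin; toℕ)
open import Data.Product using (Σ)
open import Relation.Binary.PropositionalEquality using (_≡_)
open import Data.List using (List; []; _∷_; reverse; foldl; map)
open import Data.Nat.ListAction using (sum)

-- Least-significant-first digits of the base-3/2 expansion, with fuel.
-- N_0 = n, 2 N_i = 3 N_{i+1} + d_i, d_i ∈ {0,1,2}; stops when N = 0.
-- Since N_{i+1} < N_i for N_i ≥ 1, fuel n suffices.
digitsLSB : ℕ → ℕ → List (Fin 3)
digitsLSB zero    _ = []
digitsLSB (suc f) zero = []
digitsLSB (suc f) (suc m) = ((2 * suc m) mod 3) ∷ digitsLSB f ((2 * suc m) / 3)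

expansion : ℕ → List (Fin 3)
expansion n = reverse (digitsLSB n n)

tm : ℕ → ℕ
tm n = sum (map toℕ (expansion n)) % 2

-- First difference of a binary sequence: (x_{n+1} - x_n) mod 2.
Δ : (ℕ → ℕ) → ℕ → ℕ
Δ x n = (x (suc n) + x n) % 2

record DFAO : Set where
  field
    nStates : ℕ
    start   : Fin nStates
    δ       : Fin nStates → Fin 3 → Fin nStates
    out     : Fin nStates → ℕ

run : DFAO → List (Fin 3) → ℕ
run A w = DFAO.out A (foldl (DFAO.δ A) (DFAO.start A) w)

Automatic32 : (ℕ → ℕ) → Set
Automatic32 y = Σ DFAO λ A → (n : ℕ) → run A (expansion n) ≡ y n

-- Adding 1 to n adds 2 to 2n, so on least-significant-first expansions it acts as
-- a carry chain: a low digit 0 becomes 2 and stops, while 1 and 2 become 0 and 1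
-- and carry into the next digit.  The digit sums of n and n + 1 thus differ by an
-- even amount plus one odd amount per carry, so Δ(t) at n is the parity of the
-- number of trailing nonzero digits of ⟨n⟩_{3/2}.  A two-state automaton that
-- toggles on 1 and 2 and resets on 0 computes exactly this parity.
module Submission where

open import Defs
open import Data.Nat using (ℕ; zero; suc; _+_; _*_; _%_; _/_; _≤_; _<_; NonZero; s≤s; s≤s⁻¹)
open import Data.Nat.Properties using (≤-refl; ≤-trans; +-suc; *-suc; *-comm; *-monoʳ-<)
open import Data.Nat.DivMod
open import Data.Nat.Divisibility using (divides-refl)
open import Data.Fin using (Fin; toℕ) renaming (zero to 0F; suc to sucF)
open import Data.Fin.Properties using (toℕ-injective; toℕ-fromℕ<; toℕ<n)
open import Data.Product using (_,_)
open import Data.List using (List; []; _∷_; [_]; reverse; foldr; map)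
open import Data.List.Properties using (reverse-foldl; reverse-map)
open import Data.List.Relation.Binary.Permutation.Propositional.Properties using (↭-reverse)
open import Data.Nat.ListAction using (sum)
open import Data.Nat.ListAction.Properties using (sum-↭)
open import Relation.Binary.PropositionalEquality using (_≡_; refl; sym; trans; cong; cong₂; module ≡-Reasoning)

pattern 1F = sucF 0F
pattern 2F = sucF 1F

[r+qn]/n≡q : ∀ {n} .{{_ : NonZero n}} (r : Fin n) q → (toℕ r + q * n) / n ≡ q
[r+qn]/n≡q {n} r q = begin
  (toℕ r + q * n) / n       ≡⟨ +-distrib-/-∣ʳ (toℕ r) (divides-refl q) ⟩
  toℕ r / n + q * n / n     ≡⟨ cong₂ _+_ (m<n⇒m/n≡0 (toℕ<n r)) (m*n/n≡m q n) ⟩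
  q                         ∎
  where open ≡-Reasoning

[r+qn]mod-n≡r : ∀ {n} .{{_ : NonZero n}} (r : Fin n) q → (toℕ r + q * n) mod n ≡ r
[r+qn]mod-n≡r {n} r q = toℕ-injective (begin
  toℕ ((toℕ r + q * n) mod n) ≡⟨ toℕ-fromℕ< _ ⟩
  (toℕ r + q * n) % n         ≡⟨ [m+kn]%n≡m%n (toℕ r) q n ⟩
  toℕ r % n                   ≡⟨ m<n⇒m%n≡m (toℕ<n r) ⟩
  toℕ r                       ∎)
  where open ≡-Reasoning

m≡[m-mod-n]+[m/n]*n : ∀ m n .{{_ : NonZero n}} → m ≡ toℕ (m mod n) + (m / n) * n
m≡[m-mod-n]+[m/n]*n m n = trans (m≡m%n+[m/n]*n m n) (cong (_+ (m / n) * n) (sym (toℕ-fromℕ< _)))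

[2+2m]/3≤m : ∀ m → (2 * suc m) / 3 ≤ m
[2+2m]/3≤m m = s≤s⁻¹ (m<n*o⇒m/o<n 2+2m<3+3m)
  where
  2+2m<3+3m : 2 * suc m < suc m * 3
  2+2m<3+3m rewrite *-comm 2 (suc m) = *-monoʳ-< (suc m) ≤-refl

digitsLSB-step : ∀ f m r q → 2 * suc m ≡ toℕ r + q * 3 →
                 digitsLSB (suc f) (suc m) ≡ r ∷ digitsLSB f q
digitsLSB-step f m r q 2m+2≡r+3q = cong₂ _∷_
  (trans (cong (_mod 3) 2m+2≡r+3q) ([r+qn]mod-n≡r r q))
  (cong (digitsLSB f) (trans (cong (_/ 3) 2m+2≡r+3q) ([r+qn]/n≡q r q)))

digitsLSB-fuel : ∀ {f m} → m ≤ f → digitsLSB (suc f) m ≡ digitsLSB f m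
digitsLSB-fuel {zero}  {zero}  _       = refl
digitsLSB-fuel {suc f} {zero}  _       = refl
digitsLSB-fuel {suc f} {suc m} (s≤s m≤f) =
  cong (_ ∷_) (digitsLSB-fuel (≤-trans ([2+2m]/3≤m m) m≤f))

increment : List (Fin 3) → List (Fin 3)
increment []        = [ 2F ]
increment (0F ∷ ds) = 2F ∷ ds
increment (1F ∷ ds) = 0F ∷ increment ds
increment (2F ∷ ds) = 1F ∷ increment ds

digitsLSB-suc : ∀ {f m} → m ≤ f → digitsLSB (suc f) (suc m) ≡ increment (digitsLSB f m)
digitsLSB-suc {zero}  {zero}  _ = refl
digitsLSB-suc {suc f} {zero}  _ = refl
digitsLSB-suc {suc f} {suc m} (s≤s m≤f) =
  carry (2 * suc m mod 3) (trans (*-suc 2 (suc m)) (cong (2 +_) (m≡[m-mod-n]+[m/n]*n (2 * suc m) 3)))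
  where
  q = 2 * suc m / 3
  q≤f = ≤-trans ([2+2m]/3≤m m) m≤f

  -- 2 (m + 2) = 2 + r + 3q: the new low digit is r + 2, carrying once r + 2 ≥ 3.
  carry : ∀ r → 2 * suc (suc m) ≡ 2 + (toℕ r + q * 3) →
          digitsLSB (suc (suc f)) (suc (suc m)) ≡ increment (r ∷ digitsLSB f q)
  carry 0F e = trans (digitsLSB-step (suc f) (suc m) 2F q e) (cong (2F ∷_) (digitsLSB-fuel q≤f))
  carry 1F e = trans (digitsLSB-step (suc f) (suc m) 0F (suc q) e) (cong (0F ∷_) (digitsLSB-suc q≤f))
  carry 2F e = trans (digitsLSB-step (suc f) (suc m) 1F (suc q) e) (cong (1F ∷_) (digitsLSB-suc q≤f))

digitSum : List (Fin 3) → ℕ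
digitSum ds = sum (map toℕ ds)

digitSum-reverse : ∀ ds → digitSum (reverse ds) ≡ digitSum ds
digitSum-reverse ds = trans (cong sum (reverse-map toℕ ds)) (sum-↭ (↭-reverse (map toℕ ds)))

tm≡digitSum%2 : ∀ n → tm n ≡ digitSum (digitsLSB n n) % 2
tm≡digitSum%2 n = cong (_% 2) (digitSum-reverse (digitsLSB n n))

tm-suc : ∀ n → tm (suc n) ≡ digitSum (increment (digitsLSB n n)) % 2
tm-suc n = trans (tm≡digitSum%2 (suc n)) (cong (λ ds → digitSum ds % 2) (digitsLSB-suc {n} {n} ≤-refl))

toggle : Fin 2 → Fin 2
toggle 0F = 1F
toggle 1F = 0F

parity : ℕ → Fin 2
parity zero          = 0F
parity (suc zero)    = 1F
parity (suc (suc n)) = parity n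

parity-suc : ∀ n → parity (suc n) ≡ toggle (parity n)
parity-suc zero          = refl
parity-suc (suc zero)    = refl
parity-suc (suc (suc n)) = parity-suc n

parity-double : ∀ n → parity (n + n) ≡ 0F
parity-double zero    = refl
parity-double (suc n) rewrite +-suc n n = parity-double n

toℕ-parity : ∀ n → toℕ (parity n) ≡ n % 2
toℕ-parity zero          = refl
toℕ-parity (suc zero)    = refl
toℕ-parity (suc (suc n)) = trans (toℕ-parity n) (sym (%-remove-+ˡ n (divides-refl 1)))

nonzeroRunStep : Fin 2 → Fin 3 → Fin 2
nonzeroRunStep s 0F       = 0F
nonzeroRunStep s (sucF _) = toggle s

lowNonzeroRunParity : List (Fin 3) → Fin 2
lowNonzeroRunParity = foldr (λ d s → nonzeroRunStep s d) 0F

nonzeroRunAutomaton : DFAO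
nonzeroRunAutomaton = record { nStates = 2 ; start = 0F ; δ = nonzeroRunStep ; out = toℕ }

run-nonzeroRunAutomaton : ∀ n →
  run nonzeroRunAutomaton (expansion n) ≡ toℕ (lowNonzeroRunParity (digitsLSB n n))
run-nonzeroRunAutomaton n = cong toℕ (reverse-foldl nonzeroRunStep 0F (digitsLSB n n))

parity-digitSum-increment : ∀ ds →
  parity (digitSum (increment ds) + digitSum ds) ≡ lowNonzeroRunParity ds
parity-digitSum-increment []        = refl
parity-digitSum-increment (0F ∷ ds) = parity-double (digitSum ds)
parity-digitSum-increment (1F ∷ ds)
  rewrite +-suc (digitSum (increment ds)) (digitSum ds) =
  trans (parity-suc (digitSum (increment ds) + digitSum ds)) (cong toggle (parity-digitSum-increment ds))
parity-digitSum-increment (2F ∷ ds)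
  rewrite +-suc (digitSum (increment ds)) (suc (digitSum ds))
        | +-suc (digitSum (increment ds)) (digitSum ds) =
  trans (parity-suc (digitSum (increment ds) + digitSum ds)) (cong toggle (parity-digitSum-increment ds))

lemma9 : Automatic32 (Δ tm)
lemma9 = nonzeroRunAutomaton , λ n → let ds = digitsLSB n n in begin
  run nonzeroRunAutomaton (expansion n)
    ≡⟨ run-nonzeroRunAutomaton n ⟩
  toℕ (lowNonzeroRunParity ds)
    ≡⟨ cong toℕ (parity-digitSum-increment ds) ⟨
  toℕ (parity (digitSum (increment ds) + digitSum ds))
    ≡⟨ toℕ-parity (digitSum (increment ds) + digitSum ds) ⟩
  (digitSum (increment ds) + digitSum ds) % 2
    ≡⟨ %-distribˡ-+ (digitSum (increment ds)) (digitSum ds) 2 ⟩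
  (digitSum (increment ds) % 2 + digitSum ds % 2) % 2
    ≡⟨ cong₂ (λ a b → (a + b) % 2) (tm-suc n) (tm≡digitSum%2 n) ⟨
  Δ tm n ∎
  where open ≡-Reasoning
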